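{- Let $s,t\in\mathbb{R}$ with $s\neq0$, $t\neq0$, $s^2+t\neq0$ (and $s^2+4t\neq0$). For all $n\geq0$, \[ \genfrac{\{}{\}}{0pt}{}{n+3}{3}_{s,t}=st\genfrac{\{}{\}}{0pt}{}{n+2}{3}_{s,t}+\{n+1\}_{s,t}\genfrac{\{}{\}}{0pt}{}{n+2}{2}_{s,t}. \]
   Context: Generalized Fibonacci polynomials: $\{0\}_{s,t}=0$, $\{1\}_{s,t}=1$, $\{n+2\}_{s,t}=s\{n+1\}_{s,t}+t\{n\}_{s,t}$; $\{k\}_{s,t}!=\{1\}_{s,t}\cdots\{k\}_{s,t}$. For integers $m,k\geq0$, $\genfrac{\{}{\}}{0pt}{}{m}{k}_{s,t}=\frac{\{m\}_{s,t}\{m-1\}_{s,t}\cdots\{m-k+1\}_{s,t}}{\{k\}_{s,t}!}$ (so $\genfrac{\{}{\}}{0pt}{}{n+2}{3}_{s,t}=\frac{\{n\}\{n+1\}\{n+2\}}{\{3\}!}$ are the generalized tetrahedral numbers). -}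

module Defs where

open import Level using (_⊔_) renaming (suc to lsuc)
open import Data.Nat using (ℕ; zero; suc; _∸_)
open import Algebra.Bundles using (CommutativeRing)
open import Relation.Nullary using (¬_)

record Field (c ℓ : Level.Level) : Set (lsuc (c ⊔ ℓ)) where
  field
    commutativeRing : CommutativeRing c ℓ
  open CommutativeRing commutativeRing public
  field
    _⁻¹      : Carrier → Carrier
    ⁻¹-inverse : ∀ x → ¬ (x ≈ 0#) → x * (x ⁻¹) ≈ 1#
    1≉0      : ¬ (1# ≈ 0#)

module FibPoly {c ℓ} (F : Field c ℓ) (s t : Field.Carrier F) where
  open Field F

  fib : ℕ → Carrier
  fib zero = 0#
  fib (suc zero) = 1#
  fib (suc (suc n)) = s * fib (suc n) + t * fib n

  fact : ℕ → Carrier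
  fact zero = 1#
  fact (suc k) = fact k * fib (suc k)

  falling : ℕ → ℕ → Carrier
  falling m zero = 1#
  falling m (suc k) = falling m k * fib (m ∸ k)

  binom : ℕ → ℕ → Carrier
  binom m k = falling m k * (fact k ⁻¹)

{-# OPTIONS --safe #-}
-- The addition formula {m + n + 1} = {m + 1}{n + 1} + t{m}{n} at m = 2 gives
-- {n + 3} = {3}{n + 1} + st{n}.  Multiplying by {n + 2}{n + 1}/{3}! turns the left
-- side into {n+3 choose 3}, and, since {3}! = {2}{3}, the two terms on the right
-- into st{n+2 choose 3} and {n + 1}{n+2 choose 2}.
module Submission where

open import Defs
open import Data.Nat using (ℕ; zero; suc; _∸_) renaming (_+_ to _+ℕ_)
open import Data.Nat.Properties using (+-comm)
open import Relation.Nullary using (¬_)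
import Algebra.Solver.Ring.NaturalCoefficients.Default as NaturalSolver
import Relation.Binary.Reasoning.Setoid as SetoidReasoning

module FieldProperties {c ℓ} (F : Field c ℓ) where
  open Field F
  open NaturalSolver commutativeSemiring
  open SetoidReasoning setoid

  x≈0⇒x*y≈0 : ∀ {x} y → x ≈ 0# → x * y ≈ 0#
  x≈0⇒x*y≈0 y x≈0 = trans (*-congʳ x≈0) (zeroˡ y)

  x≉0⇒x*y≈0⇒y≈0 : ∀ {x y} → ¬ (x ≈ 0#) → x * y ≈ 0# → y ≈ 0#
  x≉0⇒x*y≈0⇒y≈0 {x} {y} x≉0 xy≈0 = begin
    y               ≈⟨ sym (*-identityˡ y) ⟩
    1# * y          ≈⟨ *-congʳ (sym (⁻¹-inverse x x≉0)) ⟩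
    (x * x ⁻¹) * y  ≈⟨ solve 3 (λ x x⁻¹ y → (x :* x⁻¹) :* y := x⁻¹ :* (x :* y)) refl x (x ⁻¹) y ⟩
    x ⁻¹ * (x * y)  ≈⟨ *-congˡ xy≈0 ⟩
    x ⁻¹ * 0#       ≈⟨ zeroʳ (x ⁻¹) ⟩
    0#              ∎

  x≉0∧y≉0⇒x*y≉0 : ∀ {x y} → ¬ (x ≈ 0#) → ¬ (y ≈ 0#) → ¬ (x * y ≈ 0#)
  x≉0∧y≉0⇒x*y≉0 x≉0 y≉0 xy≈0 = y≉0 (x≉0⇒x*y≈0⇒y≈0 x≉0 xy≈0)

  x⁻¹≈y*[x*y]⁻¹ : ∀ x y → ¬ (x * y ≈ 0#) → x ⁻¹ ≈ y * (x * y) ⁻¹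
  x⁻¹≈y*[x*y]⁻¹ x y xy≉0 = begin
    x ⁻¹                              ≈⟨ sym (*-identityʳ (x ⁻¹)) ⟩
    x ⁻¹ * 1#                         ≈⟨ *-congˡ (sym (⁻¹-inverse (x * y) xy≉0)) ⟩
    x ⁻¹ * ((x * y) * (x * y) ⁻¹)     ≈⟨ solve 4 (λ x x⁻¹ y z → x⁻¹ :* ((x :* y) :* z) := (x :* x⁻¹) :* (y :* z))
                                              refl x (x ⁻¹) y ((x * y) ⁻¹) ⟩
    (x * x ⁻¹) * (y * (x * y) ⁻¹)     ≈⟨ *-congʳ (⁻¹-inverse x x≉0) ⟩
    1# * (y * (x * y) ⁻¹)             ≈⟨ *-identityˡ _ ⟩
    y * (x * y) ⁻¹                    ∎
    where
    x≉0 : ¬ (x ≈ 0#)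
    x≉0 x≈0 = xy≉0 (x≈0⇒x*y≈0 y x≈0)

module FibPolyProperties {c ℓ} (F : Field c ℓ) (s t : Field.Carrier F) where
  open Field F
  open FibPoly F s t
  open FieldProperties F
  open NaturalSolver commutativeSemiring
  open SetoidReasoning setoid

  fib-+ : ∀ m n → fib (suc (m +ℕ n)) ≈ fib (suc m) * fib (suc n) + t * fib m * fib n
  fib-+ zero n =
    solve 3 (λ t a b → a := con 1 :* a :+ t :* con 0 :* b) refl t (fib (suc n)) (fib n)
  fib-+ (suc zero) n =
    solve 4 (λ s t a b → s :* a :+ t :* b := (s :* con 1 :+ t :* con 0) :* a :+ t :* con 1 :* b)
      refl s t (fib (suc n)) (fib n)
  fib-+ (suc (suc m)) n = begin
    s * fib (suc (suc (m +ℕ n))) + t * fib (suc (m +ℕ n))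
      ≈⟨ +-cong (*-congˡ (fib-+ (suc m) n)) (*-congˡ (fib-+ m n)) ⟩
    s * (f₂ * g₁ + t * f₁ * g₀) + t * (f₁ * g₁ + t * f₀ * g₀)
      ≈⟨ solve 7 (λ s t f₂ f₁ f₀ g₁ g₀ →
           s :* (f₂ :* g₁ :+ t :* f₁ :* g₀) :+ t :* (f₁ :* g₁ :+ t :* f₀ :* g₀)
           := (s :* f₂ :+ t :* f₁) :* g₁ :+ t :* (s :* f₁ :+ t :* f₀) :* g₀)
           refl s t f₂ f₁ f₀ g₁ g₀ ⟩
    (s * f₂ + t * f₁) * g₁ + t * (s * f₁ + t * f₀) * g₀
      ∎
    where
    f₂ = fib (suc (suc m))
    f₁ = fib (suc m)
    f₀ = fib m
    g₁ = fib (suc n)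
    g₀ = fib n

  fib-3+n : ∀ n → fib (3 +ℕ n) ≈ fib 3 * fib (suc n) + s * t * fib n
  fib-3+n n = begin
    fib (3 +ℕ n)                                ≈⟨ fib-+ 2 n ⟩
    fib 3 * fib (suc n) + t * fib 2 * fib n     ≈⟨ +-congˡ (*-congʳ t*fib2≈s*t) ⟩
    fib 3 * fib (suc n) + s * t * fib n         ∎
    where
    t*fib2≈s*t : t * fib 2 ≈ s * t
    t*fib2≈s*t = solve 2 (λ s t → t :* (s :* con 1 :+ t :* con 0) := s :* t) refl s t

  falling-suc : ∀ m k → falling (suc m) (suc k) ≈ fib (suc m) * falling m k
  falling-suc m zero = *-comm 1# (fib (suc m))
  falling-suc m (suc k) = begin
    falling (suc m) (suc k) * fib (m ∸ k)     ≈⟨ *-congʳ (falling-suc m k) ⟩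
    fib (suc m) * falling m k * fib (m ∸ k)   ≈⟨ *-assoc _ _ _ ⟩
    fib (suc m) * (falling m k * fib (m ∸ k)) ∎

  fact-3 : fact 3 ≈ s * (s * s + t)
  fact-3 = solve 2 (λ s t → ((con 1 :* con 1) :* (s :* con 1 :+ t :* con 0))
                             :* (s :* (s :* con 1 :+ t :* con 0) :+ t :* con 1)
                         := s :* (s :* s :+ t)) refl s t

  tetrahedral-recurrence : ¬ (s ≈ 0#) → ¬ (s * s + t ≈ 0#) → ∀ n →
    binom (3 +ℕ n) 3 ≈ s * t * binom (2 +ℕ n) 3 + fib (suc n) * binom (2 +ℕ n) 2
  tetrahedral-recurrence s≉0 s²+t≉0 n = begin
    falling (3 +ℕ n) 3 * a                              ≈⟨ *-congʳ (falling-suc (2 +ℕ n) 2) ⟩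
    fib (3 +ℕ n) * P * a                                ≈⟨ *-congʳ (*-congʳ (fib-3+n n)) ⟩
    (fib 3 * fib (suc n) + s * t * fib n) * P * a
      ≈⟨ solve 6 (λ f₃ f₁ st f₀ P a →
           (f₃ :* f₁ :+ st :* f₀) :* P :* a := st :* (P :* f₀ :* a) :+ f₁ :* (P :* (f₃ :* a)))
           refl (fib 3) (fib (suc n)) (s * t) (fib n) P a ⟩
    s * t * (P * fib n * a) + fib (suc n) * (P * (fib 3 * a))
      ≈⟨ +-congˡ (*-congˡ (*-congˡ (sym (x⁻¹≈y*[x*y]⁻¹ (fact 2) (fib 3) fact3≉0)))) ⟩
    s * t * binom (2 +ℕ n) 3 + fib (suc n) * binom (2 +ℕ n) 2 ∎
    where
    P = falling (2 +ℕ n) 2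
    a = fact 3 ⁻¹
    fact3≉0 : ¬ (fact 3 ≈ 0#)
    fact3≉0 fact3≈0 = x≉0∧y≉0⇒x*y≉0 s≉0 s²+t≉0 (trans (sym fact-3) fact3≈0)

mainTheorem15 : ∀ {c ℓ} (F : Field c ℓ) (s t : Field.Carrier F) →
    let open Field F
        open FibPoly F s t
    in ¬ (s ≈ 0#) → ¬ (t ≈ 0#) → ¬ (s * s + t ≈ 0#) →
       ¬ (s * s + (1# + 1# + 1# + 1#) * t ≈ 0#) →
       (n : ℕ) →
       binom (n +ℕ 3) 3 ≈ s * t * binom (n +ℕ 2) 3 + fib (suc n) * binom (n +ℕ 2) 2
mainTheorem15 F s t s≉0 _ s²+t≉0 _ n rewrite +-comm n 3 | +-comm n 2 =
  FibPolyProperties.tetrahedral-recurrence F s t s≉0 s²+t≉0 n
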